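{- Let $S$ be a bit-string ending with bit 1, written as $S=0^{x_1-1}1\,0^{x_2-1}1\cdots0^{x_m-1}1$ with $x_i\ge1$, and let $S'=x_1x_2\cdots x_m$ be the corresponding string over the integers. If $S$ has a string attractor of size $\gamma$, then $S'$ has a string attractor of size at most $2\gamma+1$.
   Context: A string attractor of a string $T$ of length $N$ (over any alphabet, including integers) is a set $\Gamma\subseteq[1..N]$ such that every substring $T[i..j]$ has an occurrence $T[i'..j']=T[i..j]$ with some $j''\in\Gamma\cap[i'..j']$. -}

module Defs where

open import Data.Nat using (ℕ; _+_; _≤_; _<_; _∸_)
open import Data.Bool using (Bool; true; false)
open import Data.List using (List; []; _∷_; _++_; length; take; drop; replicate; concatMap)
open import Data.List.Relation.Unary.All using (All)
open import Data.List.Relation.Unary.Any using (Any)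
open import Data.Product using (Σ; _×_; ∃)
open import Relation.Binary.PropositionalEquality using (_≡_)

-- Strings over an alphabet A are lists; positions are 0-indexed,
-- so T has positions 0 .. length T - 1.

substr : ∀ {a} {A : Set a} → List A → ℕ → ℕ → List A
substr T i len = take len (drop i T)

IsAttractor : ∀ {a} {A : Set a} → List A → List ℕ → Set a
IsAttractor T Γ =
  All (λ p → p < length T) Γ ×
  (∀ i len → 1 ≤ len → i + len ≤ length T →
     Σ ℕ λ i' → (i' + len ≤ length T) ×
       (substr T i' len ≡ substr T i len) ×
       Any (λ p → (i' ≤ p) × (p < i' + len)) Γ)

-- The bit-string S = 0^{x₁-1} 1 0^{x₂-1} 1 ⋯ 0^{x_m-1} 1
-- (false = bit 0, true = bit 1) associated to x₁ x₂ ⋯ x_m.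
toBits : List ℕ → List Bool
toBits = concatMap (λ x → replicate (x ∸ 1) false ++ (true ∷ []))

-- A substring x_i ⋯ x_{i+n-1} of S' with i ≥ 1 is encoded in S, together with the 1 closing
-- block i-1, as the substring 1·toBits(x_i ⋯ x_{i+n-1}). An occurrence of it hit by Γ must also
-- start at the 1 closing some block a-1, and since the encoding of positive entries is
-- prefix-free it yields an occurrence of x_i ⋯ x_{i+n-1} at block a of S'. If the hitting
-- position p is that leading 1, block a = blockOf p + 1 is hit; otherwise p falls inside the
-- encoded blocks and blockOf p is hit. So {blockOf p, blockOf p + 1 | p ∈ Γ} together with 0,
-- which covers the substrings starting at the first block, is an attractor of S'.

module Submission where

open import Defs
open import Data.Nat using (ℕ; zero; suc; _+_; _*_; _≤_; _<_; _∸_; z≤n; s≤s; _<?_)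
open import Data.Nat.Properties
open import Data.Bool using (Bool; true; false)
open import Data.List using (List; []; _∷_; _++_; length; take; drop; replicate; map; filter; deduplicate)
open import Data.List.Properties
  using (++-assoc; concatMap-++; take++drop≡id; length-++; length-map; length-take; length-filter;
         length-deduplicate; length-replicate; ∷-injective; take-[])
open import Data.List.Relation.Unary.All using (All; []; _∷_)
import Data.List.Relation.Unary.All.Properties as All
open import Data.List.Relation.Unary.Any using (Any; here; there)
open import Data.List.Relation.Unary.Unique.Propositional using (Unique)
open import Data.List.Relation.Unary.Unique.DecPropositional.Properties _≟_ using (deduplicate-!)
open import Data.List.Membership.Propositional using (_∈_; lose; find)
open import Data.List.Membership.Propositional.Properties
  using (∈-deduplicate⁺; ∈-filter⁺; ∈-map⁺; ∈-++⁺ˡ; ∈-++⁺ʳ)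
open import Data.Product using (Σ; _×_; _,_; proj₂)
open import Data.Sum using (inj₁; inj₂; _⊎_)
open import Data.Empty using (⊥-elim)
open import Function using (_∘_)
open import Relation.Nullary using (yes; no)
open import Relation.Binary.PropositionalEquality

module _ {A : Set} where

  take-length-++ : ∀ (xs ys : List A) → take (length xs) (xs ++ ys) ≡ xs
  take-length-++ []       ys = refl
  take-length-++ (x ∷ xs) ys = cong (x ∷_) (take-length-++ xs ys)

  drop-replicate-++ : ∀ n (x : A) xs k → drop (n + k) (replicate n x ++ xs) ≡ drop k xs
  drop-replicate-++ zero    x xs k = refl
  drop-replicate-++ (suc n) x xs k = drop-replicate-++ n x xs k

  take-suc≡∷ : ∀ n (xs : List A) {y ys} → take (suc n) xs ≡ y ∷ ys →
               Σ (List A) λ zs → xs ≡ y ∷ zs × take n zs ≡ ys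
  take-suc≡∷ n (x ∷ xs) refl = xs , refl , refl

  ≤-length-drop : ∀ (xs : List A) i n → i + n ≤ length xs → n ≤ length (drop i xs)
  ≤-length-drop xs       zero    n le       = le
  ≤-length-drop (x ∷ xs) (suc i) n (s≤s le) = ≤-length-drop xs i n le

  ≤-length-drop⇒+≤ : ∀ (xs : List A) i n → 1 ≤ n → n ≤ length (drop i xs) → i + n ≤ length xs
  ≤-length-drop⇒+≤ xs       zero    n       _   le = le
  ≤-length-drop⇒+≤ []       (suc i) (suc n) _   ()
  ≤-length-drop⇒+≤ (x ∷ xs) (suc i) n       1≤n le = s≤s (≤-length-drop⇒+≤ xs i n 1≤n le)

  length-substr : ∀ (T : List A) i n → i + n ≤ length T → length (substr T i n) ≡ n
  length-substr T i n le = trans (length-take n (drop i T)) (m≤n⇒m⊓n≡m (≤-length-drop T i n le))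

  length-substr⇒+≤ : ∀ (T : List A) i n → 1 ≤ n → length (substr T i n) ≡ n → i + n ≤ length T
  length-substr⇒+≤ T i n 1≤n eq =
    ≤-length-drop⇒+≤ T i n 1≤n (m⊓n≡m⇒m≤n (trans (sym (length-take n (drop i T))) eq))

  drop≡∷++⇒+≤ : ∀ (T : List A) j {x} xs ys → drop j T ≡ x ∷ xs ++ ys → j + suc (length xs) ≤ length T
  drop≡∷++⇒+≤ T j {x} xs ys eq = ≤-length-drop⇒+≤ T j _ (s≤s z≤n) (begin
    suc (length xs)                ≤⟨ s≤s (m≤m+n (length xs) (length ys)) ⟩
    suc (length xs + length ys)    ≡⟨ cong suc (length-++ xs) ⟨
    length (x ∷ xs ++ ys)         ≡⟨ cong length eq ⟨
    length (drop j T)              ∎)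
    where open ≤-Reasoning

block : ℕ → List Bool → List Bool
block z bs = replicate z false ++ true ∷ bs

block≢[] : ∀ z bs → block z bs ≢ []
block≢[] zero    bs ()
block≢[] (suc z) bs ()

drop-block≡true∷ : ∀ z j bs {cs} → drop j (block z bs) ≡ true ∷ cs →
  (j ≡ z × cs ≡ bs) ⊎ Σ ℕ λ j′ → j ≡ z + suc j′ × drop j′ bs ≡ true ∷ cs
drop-block≡true∷ zero    zero    bs refl = inj₁ (refl , refl)
drop-block≡true∷ zero    (suc j) bs eq   = inj₂ (j , refl , eq)
drop-block≡true∷ (suc z) (suc j) bs eq with drop-block≡true∷ z j bs eq
... | inj₁ (refl , eq′)     = inj₁ (refl , eq′)
... | inj₂ (j′ , refl , eq′) = inj₂ (j′ , refl , eq′)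

take-block≡block : ∀ n z y bs cs → take n (block z bs) ≡ block y cs →
  z ≡ y × Σ ℕ λ n′ → take n′ bs ≡ cs
take-block≡block zero    z       y       bs cs eq   = ⊥-elim (block≢[] y cs (sym eq))
take-block≡block (suc n) zero    zero    bs cs refl = refl , n , refl
take-block≡block (suc n) (suc z) (suc y) bs cs eq with take-block≡block n z y bs cs (proj₂ (∷-injective eq))
... | refl , prefix = refl , prefix

Positive : List ℕ → Set
Positive = All (1 ≤_)

toBits-∷ : ∀ x xs → toBits (x ∷ xs) ≡ block (x ∸ 1) (toBits xs)
toBits-∷ x xs = ++-assoc (replicate (x ∸ 1) false) (true ∷ []) (toBits xs)

length-toBits-∷ : ∀ z xs → length (toBits (suc z ∷ xs)) ≡ suc z + length (toBits xs)
length-toBits-∷ z xs = begin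
  length (toBits (suc z ∷ xs))                             ≡⟨ cong length (toBits-∷ (suc z) xs) ⟩
  length (block z (toBits xs))                             ≡⟨ length-++ (replicate z false) ⟩
  length (replicate z false) + suc (length (toBits xs))    ≡⟨ cong (_+ _) (length-replicate z) ⟩
  z + suc (length (toBits xs))                             ≡⟨ +-suc z _ ⟩
  suc z + length (toBits xs)                               ∎
  where open ≡-Reasoning

take-toBits≡toBits : ∀ ys xs → Positive ys → Positive xs → ∀ n →
  take n (toBits xs) ≡ toBits ys → take (length ys) xs ≡ ys
take-toBits≡toBits []            xs             _          _          n eq = refl
take-toBits≡toBits (y ∷ ys)      []             _          _          n eq =
  ⊥-elim (block≢[] (y ∸ 1) (toBits ys) (trans (sym (toBits-∷ y ys)) (trans (sym eq) (take-[] n))))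
take-toBits≡toBits (suc y ∷ ys)  (suc z ∷ xs)   (_ ∷ pys)  (_ ∷ pxs)  n eq
  with take-block≡block n z y (toBits xs) (toBits ys)
         (trans (cong (take n) (sym (toBits-∷ (suc z) xs))) (trans eq (toBits-∷ (suc y) ys)))
... | refl , n′ , prefix = cong (suc y ∷_) (take-toBits≡toBits ys xs pys pxs n′ prefix)

blockOf : List ℕ → ℕ → ℕ
blockOf []       p = 0
blockOf (x ∷ xs) p with p <? x
... | yes _ = 0
... | no  _ = suc (blockOf xs (p ∸ x))

blockOf-head : ∀ x xs {p} → p < x → blockOf (x ∷ xs) p ≡ 0
blockOf-head x xs {p} p<x with p <? x
... | yes _   = refl
... | no  p≮x = ⊥-elim (p≮x p<x)

blockOf-tail : ∀ x xs q → blockOf (x ∷ xs) (x + q) ≡ suc (blockOf xs q)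
blockOf-tail x xs q with x + q <? x
... | yes x+q<x = ⊥-elim (m+n≮m x q x+q<x)
... | no  _     = cong (suc ∘ blockOf xs) (m+n∸m≡n x q)

blockOf-< : ∀ n xs → Positive xs → ∀ q → q < length (toBits (take n xs)) → blockOf xs q < n
blockOf-< (suc n) (suc z ∷ xs) (_ ∷ pxs) q q< with q <? suc z
... | yes _   = s≤s z≤n
... | no  q≮ = s≤s (blockOf-< n xs pxs (q ∸ suc z) (subst (q ∸ suc z <_) (m+n∸m≡n (suc z) _)
                 (∸-monoˡ-< (subst (q <_) (length-toBits-∷ z (take n xs)) q<) (≮⇒≥ q≮))))

toBits-boundary : ∀ k xs → k < length xs → Σ ℕ λ j → drop j (toBits xs) ≡ true ∷ toBits (drop (suc k) xs)
toBits-boundary zero (x ∷ xs) _ =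
  x ∸ 1 + 0 , trans (cong (drop (x ∸ 1 + 0)) (toBits-∷ x xs)) (drop-replicate-++ (x ∸ 1) false _ 0)
toBits-boundary (suc k) (x ∷ xs) (s≤s k<) with j , eq ← toBits-boundary k xs k< =
  x ∸ 1 + suc j ,
  trans (cong (drop (x ∸ 1 + suc j)) (toBits-∷ x xs)) (trans (drop-replicate-++ (x ∸ 1) false _ (suc j)) eq)

drop-toBits≡true∷ : ∀ xs → Positive xs → ∀ j {bs} → drop j (toBits xs) ≡ true ∷ bs →
  let k = blockOf xs j in
  bs ≡ toBits (drop (suc k) xs) × (∀ q → blockOf xs (suc j + q) ≡ suc k + blockOf (drop (suc k) xs) q)
drop-toBits≡true∷ []           []        zero    ()
drop-toBits≡true∷ []           []        (suc j) ()
drop-toBits≡true∷ (suc z ∷ xs) (_ ∷ pxs) j       eq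
  with drop-block≡true∷ z j (toBits xs) (trans (cong (drop j) (sym (toBits-∷ (suc z) xs))) eq)
... | inj₁ (refl , refl) rewrite blockOf-head (suc z) xs (n<1+n z) = refl , blockOf-tail (suc z) xs
... | inj₂ (j′ , refl , eq′) with drop-toBits≡true∷ xs pxs j′ eq′
... | bs≡ , shift rewrite +-suc z j′ | blockOf-tail (suc z) xs j′ = bs≡ , λ q → begin
  blockOf (suc z ∷ xs) (suc (suc z + j′) + q)   ≡⟨ cong (blockOf _) (trans (cong suc (+-assoc (suc z) j′ q)) (sym (+-suc (suc z) (j′ + q)))) ⟩
  blockOf (suc z ∷ xs) (suc z + suc (j′ + q))    ≡⟨ blockOf-tail (suc z) xs (suc j′ + q) ⟩
  suc (blockOf xs (suc j′ + q))                  ≡⟨ cong suc (shift q) ⟩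
  suc (suc (blockOf xs j′) + blockOf (drop (suc (blockOf xs j′)) xs) q) ∎
  where open ≡-Reasoning

toBits-occurrence : ∀ xs ys → Positive xs → Positive ys → ∀ j →
  take (suc (length (toBits ys))) (drop j (toBits xs)) ≡ true ∷ toBits ys →
  let a = suc (blockOf xs j) in
  substr xs a (length ys) ≡ ys ×
  (∀ q → q < length (toBits ys) → a ≤ blockOf xs (suc j + q) × blockOf xs (suc j + q) < a + length ys)
toBits-occurrence xs ys pxs pys j occ
  with rest , split , prefix ← take-suc≡∷ (length (toBits ys)) (drop j (toBits xs)) occ
  with rest≡ , shift ← drop-toBits≡true∷ xs pxs j split = occurs , within
  where
  a = suc (blockOf xs j)
  occurs : substr xs a (length ys) ≡ ys
  occurs = take-toBits≡toBits ys (drop a xs) pys (All.drop⁺ a pxs) _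
             (subst (λ bs → take (length (toBits ys)) bs ≡ toBits ys) rest≡ prefix)
  within : ∀ q → q < length (toBits ys) → a ≤ blockOf xs (suc j + q) × blockOf xs (suc j + q) < a + length ys
  within q q< rewrite shift q =
    m≤m+n a _ , +-monoʳ-< a (blockOf-< (length ys) (drop a xs) (All.drop⁺ a pxs) q
                                (subst (λ zs → q < length (toBits zs)) (sym occurs) q<))

blockCandidates : List ℕ → List ℕ → List ℕ
blockCandidates xs Γ = 0 ∷ map (blockOf xs) Γ ++ map (suc ∘ blockOf xs) Γ

blockAttractor : List ℕ → List ℕ → List ℕ
blockAttractor xs Γ = deduplicate _≟_ (filter (_<? length xs) (blockCandidates xs Γ))

length-blockCandidates : ∀ xs Γ → length (blockCandidates xs Γ) ≡ 2 * length Γ + 1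
length-blockCandidates xs Γ = begin
  suc (length (map (blockOf xs) Γ ++ map (suc ∘ blockOf xs) Γ))  ≡⟨ cong suc (length-++ (map (blockOf xs) Γ)) ⟩
  suc (length (map (blockOf xs) Γ) + length (map (suc ∘ blockOf xs) Γ))
    ≡⟨ cong suc (cong₂ _+_ (length-map (blockOf xs) Γ) (length-map (suc ∘ blockOf xs) Γ)) ⟩
  suc (length Γ + length Γ)                                       ≡⟨ cong (λ m → suc (length Γ + m)) (+-identityʳ (length Γ)) ⟨
  suc (2 * length Γ)                                              ≡⟨ +-comm 1 _ ⟩
  2 * length Γ + 1                                                ∎
  where open ≡-Reasoning

length-blockAttractor : ∀ xs Γ → length (blockAttractor xs Γ) ≤ 2 * length Γ + 1
length-blockAttractor xs Γ = begin
  length (blockAttractor xs Γ)                              ≤⟨ length-deduplicate _≟_ (filter (_<? length xs) (blockCandidates xs Γ)) ⟩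
  length (filter (_<? length xs) (blockCandidates xs Γ))    ≤⟨ length-filter (_<? length xs) (blockCandidates xs Γ) ⟩
  length (blockCandidates xs Γ)                             ≡⟨ length-blockCandidates xs Γ ⟩
  2 * length Γ + 1                                          ∎
  where open ≤-Reasoning

blockAttractor-inBounds : ∀ xs Γ → All (_< length xs) (blockAttractor xs Γ)
blockAttractor-inBounds xs Γ = All.deduplicate⁺ _≟_ (All.all-filter (_<? length xs) (blockCandidates xs Γ))

∈-blockAttractor⁺ : ∀ xs Γ {c} → c ∈ blockCandidates xs Γ → c < length xs → c ∈ blockAttractor xs Γ
∈-blockAttractor⁺ xs Γ c∈ c< = ∈-deduplicate⁺ _≟_ (∈-filter⁺ (_<? length xs) c∈ c<)

HitOccurrence : ∀ {A : Set} → List A → List ℕ → ℕ → ℕ → Set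
HitOccurrence T Γ i n =
  Σ ℕ λ i′ → (i′ + n ≤ length T) × (substr T i′ n ≡ substr T i n) × Any (λ p → (i′ ≤ p) × (p < i′ + n)) Γ

occurrence-transfer : ∀ xs Γ → Positive xs → ∀ ys n → Positive ys → length ys ≡ n → 1 ≤ n → ∀ i′ →
  take (suc (length (toBits ys))) (drop i′ (toBits xs)) ≡ true ∷ toBits ys →
  Any (λ p → (i′ ≤ p) × (p < i′ + suc (length (toBits ys)))) Γ →
  Σ ℕ λ a → (a + n ≤ length xs) × (substr xs a n ≡ ys) × Any (λ c → (a ≤ c) × (c < a + n)) (blockAttractor xs Γ)
occurrence-transfer xs Γ pxs ys _ pys refl 1≤n i′ occ hit
  with occurs , within ← toBits-occurrence xs ys pxs pys i′ occ = a , a+n≤ , occurs , hitAttractor hit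
  where
  a = suc (blockOf xs i′)
  m = length (toBits ys)
  a+n≤ : a + length ys ≤ length xs
  a+n≤ = length-substr⇒+≤ xs a (length ys) 1≤n (cong length occurs)
  candidate : ∀ {p} → p ∈ Γ → i′ ≤ p → p < i′ + suc m →
    Σ ℕ λ c → c ∈ blockCandidates xs Γ × (a ≤ c) × (c < a + length ys)
  candidate {p} p∈Γ i′≤p p< with m≤n⇒m<n∨m≡n i′≤p
  ... | inj₂ refl = a , there (∈-++⁺ʳ _ (∈-map⁺ (suc ∘ blockOf xs) p∈Γ)) , ≤-refl , m<m+n a 1≤n
  ... | inj₁ i′<p with q , refl ← m≤n⇒∃[o]m+o≡n i′<p =
    blockOf xs p , there (∈-++⁺ˡ (∈-map⁺ (blockOf xs) p∈Γ)) ,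
    within q (+-cancelˡ-< (suc i′) q m (subst (suc i′ + q <_) (+-suc i′ m) p<))
  hitAttractor : Any (λ p → (i′ ≤ p) × (p < i′ + suc m)) Γ →
    Any (λ c → (a ≤ c) × (c < a + length ys)) (blockAttractor xs Γ)
  hitAttractor hit with p , p∈Γ , i′≤p , p< ← find hit with c , c∈ , a≤c , c< ← candidate p∈Γ i′≤p p< =
    lose (∈-blockAttractor⁺ xs Γ c∈ (<-≤-trans c< a+n≤)) (a≤c , c<)

toBits-boundary-before : ∀ xs k n → suc k + n ≤ length xs →
  Σ ℕ λ j → Σ (List Bool) λ bs → drop j (toBits xs) ≡ true ∷ toBits (substr xs (suc k) n) ++ bs
toBits-boundary-before xs k n bound with j , eq ← toBits-boundary k xs (≤-trans (m≤m+n (suc k) n) bound) =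
  j , toBits (drop n (drop (suc k) xs)) , (begin
    drop j (toBits xs)                                                        ≡⟨ eq ⟩
    true ∷ toBits (drop (suc k) xs)                                           ≡⟨ cong (λ zs → true ∷ toBits zs) (take++drop≡id n _) ⟨
    true ∷ toBits (substr xs (suc k) n ++ drop n (drop (suc k) xs))           ≡⟨ cong (true ∷_) (concatMap-++ _ (substr xs (suc k) n) _) ⟩
    true ∷ toBits (substr xs (suc k) n) ++ toBits (drop n (drop (suc k) xs))  ∎)
  where open ≡-Reasoning

blockAttractor-hits : ∀ xs Γ → Positive xs →
  (∀ i n → 1 ≤ n → i + n ≤ length (toBits xs) → HitOccurrence (toBits xs) Γ i n) →
  ∀ i n → 1 ≤ n → i + n ≤ length xs → HitOccurrence xs (blockAttractor xs Γ) i n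
blockAttractor-hits xs Γ pxs hits zero n 1≤n bound =
  0 , bound , refl , lose (∈-blockAttractor⁺ xs Γ (here refl) (≤-trans 1≤n bound)) (z≤n , 1≤n)
blockAttractor-hits xs Γ pxs hits (suc k) n 1≤n bound
  with j , bs , eq ← toBits-boundary-before xs k n bound
  with i′ , _ , i′-occ , i′-hit ←
         hits j (suc (length (toBits (substr xs (suc k) n)))) (s≤s z≤n) (drop≡∷++⇒+≤ (toBits xs) j _ bs eq) =
  occurrence-transfer xs Γ pxs ys n (All.take⁺ n (All.drop⁺ (suc k) pxs)) (length-substr xs (suc k) n bound) 1≤n i′
    (trans i′-occ (trans (cong (take (suc (length (toBits ys)))) eq) (cong (true ∷_) (take-length-++ (toBits ys) bs))))
    i′-hit
  where
  ys = substr xs (suc k) n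

lemma20 : (xs : List ℕ) → All (λ x → 1 ≤ x) xs →
    (γ : ℕ) (Γ : List ℕ) → Unique Γ → length Γ ≡ γ → IsAttractor (toBits xs) Γ →
      Σ (List ℕ) λ Γ' → Unique Γ' × (length Γ' ≤ 2 * γ + 1) × IsAttractor xs Γ'
lemma20 xs pxs _ Γ _ refl (_ , hits) =
  blockAttractor xs Γ ,
  deduplicate-! (filter (_<? length xs) (blockCandidates xs Γ)) ,
  length-blockAttractor xs Γ ,
  blockAttractor-inBounds xs Γ ,
  blockAttractor-hits xs Γ pxs hits
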